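{- Let $U$ be a word that is not pre-Galois. Then for every word $V$, the word $UV$ is not pre-Galois. Equivalently, every prefix of a pre-Galois word is pre-Galois.
   Context: Alternating order: for words $S,T$ with $S^\omega\neq T^\omega$ ($X^\omega$ the infinite repetition of $X$), let $j$ be the first position with $S^\omega[j]\neq T^\omega[j]$; $S\prec_{\mathrm{alt}}T$ if $j$ is odd and $S^\omega[j]<T^\omega[j]$, or $j$ is even and $S^\omega[j]>T^\omega[j]$. $S=_{\mathrm{alt}}T$ if $S^\omega=T^\omega$; $\varepsilon\succ_{\mathrm{alt}}X$ for every nonempty $X$. A word $T$ is pre-Galois if every proper suffix $S$ of $T$ is a prefix of $T$ or satisfies $S\succ_{\mathrm{alt}}T$. -}

module Defs where

open import Level using (Level; _⊔_)
open import Data.Nat using (ℕ; zero; suc; _<_; _≤_; _%_; NonZero)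
open import Data.Nat.DivMod using (m%n<n)
open import Data.Fin using (fromℕ<)
open import Data.List using (List; []; _∷_; _++_; length; drop; lookup)
open import Data.Product using (Σ; ∃; _×_; _,_)
open import Data.Sum using (_⊎_)
open import Data.Empty using (⊥)
open import Data.Unit using (⊤)
open import Relation.Binary.PropositionalEquality using (_≡_)
open import Relation.Binary.Core using (Rel)

-- Infinite repetition (x ∷ xs)^ω as a function ℕ → A (0-indexed positions).
omega : ∀ {a} {A : Set a} → A → List A → ℕ → A
omega x xs i = lookup (x ∷ xs) (fromℕ< (m%n<n i (suc (length xs))))

-- A 0-indexed position j corresponds to the 1-indexed position j+1,
-- which is odd iff j is even.
Even : ℕ → Set
Even j = j % 2 ≡ 0

Odd : ℕ → Set
Odd j = j % 2 ≡ 1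

AltLess : ∀ {a ℓ} {A : Set a} → Rel A ℓ → List A → List A → Set (a ⊔ ℓ)
AltLess _<ₐ_ [] T = Level.Lift _ ⊥
AltLess _<ₐ_ (x ∷ xs) [] = Level.Lift _ ⊤
AltLess {A = A} _<ₐ_ (x ∷ xs) (y ∷ ys) =
  ∃ λ (j : ℕ) →
    (∀ k → k < j → omega x xs k ≡ omega y ys k)
    × ((Even j × (omega x xs j <ₐ omega y ys j))
       ⊎ (Odd j × (omega y ys j <ₐ omega x xs j)))

IsPrefix : ∀ {a} {A : Set a} → List A → List A → Set a
IsPrefix S T = ∃ λ R → S ++ R ≡ T

PreGalois : ∀ {a ℓ} {A : Set a} → Rel A ℓ → List A → Set (a ⊔ ℓ)
PreGalois _<ₐ_ T =
  ∀ (k : ℕ) → 1 ≤ k → k ≤ length T →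
    IsPrefix (drop k T) T ⊎ AltLess _<ₐ_ T (drop k T)

{-# OPTIONS --safe #-}
module Submission where

-- The proper suffixes of U ++ V that matter are S ++ V with S a proper suffix of U.  If
-- S ++ V is a prefix of U ++ V, then S is a prefix of U.  Otherwise U ++ V ≺alt S ++ V,
-- first differing at some position j; since (U ++ V)^ω and (S ++ V)^ω coincide with U^ω
-- and S^ω on the first |S| positions, either j < |S| and U ≺alt S at the same position j,
-- or U^ω and S^ω agree on the first |S| positions, making S a prefix of U.

open import Defs
open import Data.List using (List; []; _∷_; _++_; length; drop; lookup)
open import Data.List.Properties using (length-++; length-drop; ++-assoc; ∷-injective)
open import Data.Fin using (fromℕ<)
open import Data.Fin.Properties using (fromℕ<-cong)
open import Data.Nat using (ℕ; zero; suc; _<_; _≤_; s≤s; z<s; s<s; _<?_)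
open import Data.Nat.Properties
  using (≤-trans; <-≤-trans; <-trans; <⇒≤; ≮⇒≥; m≤m+n; ∸-monoʳ-<)
open import Data.Nat.DivMod using (m<n⇒m%n≡m)
open import Data.Product using (_,_; _×_)
open import Data.Sum using (_⊎_; inj₁; inj₂)
open import Level using (_⊔_)
open import Relation.Binary.Core using (Rel)
open import Relation.Binary.Structures using (IsStrictTotalOrder)
open import Relation.Binary.PropositionalEquality
  using (_≡_; refl; sym; trans; cong; subst; subst₂; module ≡-Reasoning)
open import Relation.Nullary using (¬_; yes; no)

module _ {a} {A : Set a} where

  length-++-≤ : ∀ (xs ys : List A) → length xs ≤ length (xs ++ ys)
  length-++-≤ xs ys = subst (length xs ≤_) (sym (length-++ xs)) (m≤m+n _ _)

  drop-++ : ∀ k (xs ys : List A) → k ≤ length xs → drop k (xs ++ ys) ≡ drop k xs ++ ys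
  drop-++ zero    xs       ys _         = refl
  drop-++ (suc k) (x ∷ xs) ys (s≤s k≤n) = drop-++ k xs ys k≤n

  lookup-++ˡ : ∀ (xs ys : List A) {k} (p : k < length xs) .(q : k < length (xs ++ ys)) →
               lookup (xs ++ ys) (fromℕ< q) ≡ lookup xs (fromℕ< p)
  lookup-++ˡ (x ∷ xs) ys {zero}  _       _ = refl
  lookup-++ˡ (x ∷ xs) ys {suc k} (s<s p) q = lookup-++ˡ xs ys p _

  ++-≡⇒IsPrefix : ∀ (S U : List A) {X Y} → S ++ X ≡ U ++ Y → length S ≤ length U → IsPrefix S U
  ++-≡⇒IsPrefix []      U       _ _ = U , refl
  ++-≡⇒IsPrefix (s ∷ S) (u ∷ U) e (s≤s S≤U) with ∷-injective e
  ... | refl , e′ with ++-≡⇒IsPrefix S U e′ S≤U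
  ...   | R , refl = R , refl

  lookup-≡⇒IsPrefix : ∀ (S U : List A) → length S ≤ length U →
    (∀ {k} (p : k < length S) (q : k < length U) → lookup S (fromℕ< p) ≡ lookup U (fromℕ< q)) →
    IsPrefix S U
  lookup-≡⇒IsPrefix []      U       _         _     = U , refl
  lookup-≡⇒IsPrefix (s ∷ S) (u ∷ U) (s≤s S≤U) agree
    with agree z<s z<s | lookup-≡⇒IsPrefix S U S≤U (λ p q → agree (s<s p) (s<s q))
  ... | refl | R , refl = R , refl

  omega-lookup : ∀ x (xs : List A) {k} (p : k < length (x ∷ xs)) →
                 omega x xs k ≡ lookup (x ∷ xs) (fromℕ< p)
  omega-lookup x xs p = cong (lookup (x ∷ xs)) (fromℕ<-cong _ _ (m<n⇒m%n≡m p) _ p)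

  omega-++ : ∀ x (xs ys : List A) {k} → k < length (x ∷ xs) → omega x (xs ++ ys) k ≡ omega x xs k
  omega-++ x xs ys {k} p = begin
    omega x (xs ++ ys) k              ≡⟨ omega-lookup x (xs ++ ys) q ⟩
    lookup (x ∷ xs ++ ys) (fromℕ< q)  ≡⟨ lookup-++ˡ (x ∷ xs) ys p q ⟩
    lookup (x ∷ xs) (fromℕ< p)        ≡⟨ omega-lookup x xs p ⟨
    omega x xs k                      ∎
    where
      open ≡-Reasoning
      q : k < length (x ∷ xs ++ ys)
      q = <-≤-trans p (length-++-≤ (x ∷ xs) ys)

  omega-≡-++⁻ : ∀ u U s S V {k} → k < length (s ∷ S) → length (s ∷ S) ≤ length (u ∷ U) →
                omega u (U ++ V) k ≡ omega s (S ++ V) k → omega s S k ≡ omega u U k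
  omega-≡-++⁻ u U s S V {k} k<|S| S≤U e = begin
    omega s S k         ≡⟨ omega-++ s S V k<|S| ⟨
    omega s (S ++ V) k  ≡⟨ e ⟨
    omega u (U ++ V) k  ≡⟨ omega-++ u U V (<-≤-trans k<|S| S≤U) ⟩
    omega u U k         ∎
    where open ≡-Reasoning

  omega-≡⇒IsPrefix : ∀ s S u U → length (s ∷ S) ≤ length (u ∷ U) →
    (∀ k → k < length (s ∷ S) → omega s S k ≡ omega u U k) → IsPrefix (s ∷ S) (u ∷ U)
  omega-≡⇒IsPrefix s S u U S≤U agree = lookup-≡⇒IsPrefix (s ∷ S) (u ∷ U) S≤U λ p q →
    trans (sym (omega-lookup s S p)) (trans (agree _ p) (omega-lookup u U q))

  module _ {ℓ} (_<ₐ_ : Rel A ℓ) where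

    AltLessAt : ℕ → A → A → Set ℓ
    AltLessAt j x y = (Even j × (x <ₐ y)) ⊎ (Odd j × (y <ₐ x))

    PreGaloisSuffix : List A → List A → Set (a ⊔ ℓ)
    PreGaloisSuffix T S = IsPrefix S T ⊎ AltLess _<ₐ_ T S

    altLess-++⁻ : ∀ (U S V : List A) → length S < length U →
                  AltLess _<ₐ_ (U ++ V) (S ++ V) → PreGaloisSuffix U S
    altLess-++⁻ (u ∷ U) []      V _   _ = inj₂ _
    altLess-++⁻ (u ∷ U) (s ∷ S) V S<U (j , agree , differ) with j <? length (s ∷ S)
    ... | yes j<|S| = inj₂ (j , agree′ , differ′)
      where
        agree′ : ∀ k → k < j → omega u U k ≡ omega s S k
        agree′ k k<j = sym (omega-≡-++⁻ u U s S V (<-trans k<j j<|S|) (<⇒≤ S<U) (agree k k<j))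

        differ′ : AltLessAt j (omega u U j) (omega s S j)
        differ′ = subst₂ (AltLessAt j) (omega-++ u U V (<-trans j<|S| S<U)) (omega-++ s S V j<|S|) differ
    ... | no j≮|S| = inj₁ (omega-≡⇒IsPrefix s S u U (<⇒≤ S<U) λ k k<|S| →
            omega-≡-++⁻ u U s S V k<|S| (<⇒≤ S<U) (agree k (<-≤-trans k<|S| (≮⇒≥ j≮|S|))))

    preGaloisSuffix-++⁻ : ∀ (U S V : List A) → length S < length U →
                          PreGaloisSuffix (U ++ V) (S ++ V) → PreGaloisSuffix U S
    preGaloisSuffix-++⁻ U S V S<U (inj₁ (R , e)) =
      inj₁ (++-≡⇒IsPrefix S U (trans (sym (++-assoc S V R)) e) (<⇒≤ S<U))
    preGaloisSuffix-++⁻ U S V S<U (inj₂ U++V<S++V) = altLess-++⁻ U S V S<U U++V<S++V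

    preGalois-++⁻ : ∀ (U V : List A) → PreGalois _<ₐ_ (U ++ V) → PreGalois _<ₐ_ U
    preGalois-++⁻ U V pg k 1≤k k≤|U| = preGaloisSuffix-++⁻ U (drop k U) V |drop|<|U| suffix
      where
        |drop|<|U| : length (drop k U) < length U
        |drop|<|U| = subst (_< length U) (sym (length-drop k U)) (∸-monoʳ-< 1≤k k≤|U|)

        suffix : PreGaloisSuffix (U ++ V) (drop k U ++ V)
        suffix = subst (PreGaloisSuffix (U ++ V)) (drop-++ k U V k≤|U|)
                       (pg k 1≤k (≤-trans k≤|U| (length-++-≤ U V)))

lemma10 : ∀ {a ℓ} (A : Set a) (_<ₐ_ : Rel A ℓ) → IsStrictTotalOrder _≡_ _<ₐ_ →
    (U V : List A) → ¬ PreGalois _<ₐ_ U → ¬ PreGalois _<ₐ_ (U ++ V)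
lemma10 A _<ₐ_ _ U V ¬pgU pgUV = ¬pgU (preGalois-++⁻ _<ₐ_ U V pgUV)
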